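{- Let $1\le \ell< n$ and $\delta<1$. If there is a random tape streaming algorithm for $\textsc{mif}(n,\ell)$ using $z$ bits of space such that on every fixed input stream in $[n]^\ell$ it produces an incorrect output with probability at most $\delta$, then $z \ge \log_2(\ell+1)$.
   Context: The Missing Item Finding problem $\textsc{mif}(n,\ell)$: the input is a stream $e_1,\dots,e_\ell$ with each $e_i\in[n]$; after receiving $e_i$ the algorithm must output some $v\in[n]\setminus\{e_1,\dots,e_i\}$. A streaming algorithm has finite state set $\Sigma$ with $|\Sigma|\le 2^z$ ($z$ bits of space). A random tape algorithm draws its initial state from a distribution over $\Sigma$ and on each input moves to a state determined by the current state, the input and fresh independent randomness; its output is a deterministic function of its current state.
   Formalization: The probabilities of the algorithm's initial-state distribution and of its state transitions, as well as the error bound δ, are rational. -}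

module Defs where

open import Data.Nat using (ℕ; zero; suc; _^_) renaming (_≤_ to _≤ℕ_)
open import Data.Fin using (Fin; zero; suc) renaming (_≟_ to _≟F_)
open import Data.List using (List; []; _∷_)
open import Data.Vec using (Vec; []; _∷_)
open import Data.Bool using (Bool; true; false; if_then_else_)
open import Data.Rational using (ℚ; 0ℚ; 1ℚ; _+_; _*_; _-_; _≤_)
open import Relation.Nullary.Decidable using (does)
open import Relation.Binary.PropositionalEquality using (_≡_)

sumFin : (s : ℕ) → (Fin s → ℚ) → ℚ
sumFin zero    f = 0ℚ
sumFin (suc s) f = f zero + sumFin s (λ i → f (suc i))

elem : {n : ℕ} → Fin n → List (Fin n) → Bool
elem x []       = false
elem x (y ∷ ys) = does (x ≟F y) Data.Bool.∨ elem x ys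

-- The initial state is drawn from the
-- distribution `init`; on input e in state σ the next state is σ' with
-- probability `trans σ e σ'` (the distribution induced by the fresh
-- independent randomness); the output is the deterministic function `out`
-- of the current state.
record RandomTapeAlg (n : ℕ) : Set where
  field
    states      : ℕ
    init        : Fin states → ℚ
    trans       : Fin states → Fin n → Fin states → ℚ
    out         : Fin states → Fin n
    init-nonneg : ∀ σ → 0ℚ ≤ init σ
    init-sum    : sumFin states init ≡ 1ℚ
    trans-nonneg : ∀ σ e σ' → 0ℚ ≤ trans σ e σ'
    trans-sum    : ∀ σ e → sumFin states (trans σ e) ≡ 1ℚ

UsesSpace : {n : ℕ} → RandomTapeAlg n → ℕ → Set
UsesSpace A z = RandomTapeAlg.states A ≤ℕ 2 ^ z

-- goodFrom A σ seen es : probability that, started in state σ after having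
-- already received the items `seen`, processing the remaining stream `es`,
-- every output produced (one after each received item) is correct, i.e. not
-- among the items received so far.
goodFrom : {n m : ℕ} (A : RandomTapeAlg n) →
           Fin (RandomTapeAlg.states A) → List (Fin n) → Vec (Fin n) m → ℚ
goodFrom A σ seen []       = 1ℚ
goodFrom A σ seen (e ∷ es) =
  sumFin (RandomTapeAlg.states A) (λ σ' →
    RandomTapeAlg.trans A σ e σ' *
      (if elem (RandomTapeAlg.out A σ') (e ∷ seen)
         then 0ℚ
         else goodFrom A σ' (e ∷ seen) es))

errorProb : {n ℓ : ℕ} → RandomTapeAlg n → Vec (Fin n) ℓ → ℚ
errorProb A es =
  1ℚ - sumFin (RandomTapeAlg.states A)
               (λ σ → RandomTapeAlg.init A σ * goodFrom A σ [] es)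

SolvesMIF : (n ℓ : ℕ) → RandomTapeAlg n → ℚ → Set
SolvesMIF n ℓ A δ = (es : Vec (Fin n) ℓ) → errorProb A es ≤ δ

{-# OPTIONS --safe #-}
module Submission where

-- An algorithm with s ≤ ℓ states is defeated by a single deterministic stream:
-- the outputs of all s states, padded to length ℓ. After the last item every
-- state outputs an item already received, so whatever the randomness the final
-- output is wrong and the error probability is 1 > δ. Hence 2^z ≥ s ≥ ℓ + 1.

open import Defs
open import Data.Nat using (ℕ; zero; suc; s≤s; _≤_; _<_; _+_)
open import Data.Nat.Properties using (≰⇒>; ≤-trans; +-comm)
open import Data.Nat.Logarithm using (⌈log₂_⌉; ⌈log₂⌉-mono-≤; ⌈log₂2^n⌉≡n)
open import Data.Rational using (ℚ; 0ℚ; _*_; _-_) renaming (_<_ to _<ℚ_; _≤_ to _≤ℚ_; 1ℚ to 1q)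
open import Data.Rational.Properties using (*-zeroʳ; <-irrefl; ≤-<-trans)
open import Data.Fin using (Fin; zero; suc) renaming (_≟_ to _≟F_)
open import Data.List using (List; []; _∷_)
open import Data.Vec using (Vec; []; _∷_; tabulate; padRight)
open import Data.Vec.Relation.Unary.Any using (here; there)
open import Data.Vec.Membership.Propositional using (_∈_)
open import Data.Vec.Membership.Propositional.Properties using (∈-tabulate⁺)
open import Data.Bool using (true; if_then_else_)
open import Data.Bool.Properties using (∨-zeroʳ; if-eta)
open import Relation.Nullary.Decidable using (does; dec-true)
open import Relation.Binary.PropositionalEquality using (_≡_; refl; cong; subst)

sumFin-zero : ∀ s {f : Fin s → ℚ} → (∀ i → f i ≡ 0ℚ) → sumFin s f ≡ 0ℚ
sumFin-zero zero    f≡0 = refl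
sumFin-zero (suc s) f≡0 rewrite f≡0 zero | sumFin-zero s (λ i → f≡0 (suc i)) = refl

∈-padRight⁺ : ∀ {A : Set} {m l} {x a : A} {xs : Vec A m} (m≤l : m ≤ l) →
              x ∈ xs → x ∈ padRight m≤l a xs
∈-padRight⁺ (s≤s m≤l) (here x≡y)   = here x≡y
∈-padRight⁺ (s≤s m≤l) (there x∈xs) = there (∈-padRight⁺ m≤l x∈xs)

module _ {n : ℕ} where

  elem-∷-self : (x : Fin n) (ys : List (Fin n)) → elem x (x ∷ ys) ≡ true
  elem-∷-self x ys rewrite dec-true (x ≟F x) refl = refl

  elem-∷⁺ : (x y : Fin n) (ys : List (Fin n)) → elem x ys ≡ true → elem x (y ∷ ys) ≡ true
  elem-∷⁺ x y ys x∈ys rewrite x∈ys = ∨-zeroʳ (does (x ≟F y))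

  receiveAll : ∀ {m} → Vec (Fin n) m → List (Fin n) → List (Fin n)
  receiveAll []       seen = seen
  receiveAll (e ∷ es) seen = receiveAll es (e ∷ seen)

  elem-receiveAll-seen : ∀ {m} (x : Fin n) (es : Vec (Fin n) m) (seen : List (Fin n)) →
                         elem x seen ≡ true → elem x (receiveAll es seen) ≡ true
  elem-receiveAll-seen x []       seen x∈seen = x∈seen
  elem-receiveAll-seen x (e ∷ es) seen x∈seen =
    elem-receiveAll-seen x es (e ∷ seen) (elem-∷⁺ x e seen x∈seen)

  elem-receiveAll : ∀ {m} {x : Fin n} {es : Vec (Fin n) m} (seen : List (Fin n)) →
                    x ∈ es → elem x (receiveAll es seen) ≡ true
  elem-receiveAll {x = x} {_ ∷ es} seen (here refl)  =
    elem-receiveAll-seen x es (x ∷ seen) (elem-∷-self x seen)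
  elem-receiveAll {es = e ∷ _}     seen (there x∈es) = elem-receiveAll (e ∷ seen) x∈es

module _ {n : ℕ} (A : RandomTapeAlg n) where
  open RandomTapeAlg A

  AllOutputsSeen : List (Fin n) → Set
  AllOutputsSeen seen = ∀ σ → elem (out σ) seen ≡ true

  goodFrom-exhausted : ∀ {m} σ seen (es : Vec (Fin n) (suc m)) →
                       AllOutputsSeen (receiveAll es seen) → goodFrom A σ seen es ≡ 0ℚ
  goodFrom-exhausted σ seen (e ∷ []) seen-all = sumFin-zero states step
    where
    step : ∀ σ' → trans σ e σ' * (if elem (out σ') (e ∷ seen) then 0ℚ else 1q) ≡ 0ℚ
    step σ' rewrite seen-all σ' = *-zeroʳ (trans σ e σ')
  goodFrom-exhausted σ seen (e ∷ e' ∷ es) seen-all = sumFin-zero states step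
    where
    step : ∀ σ' → trans σ e σ' * (if elem (out σ') (e ∷ seen)
                                    then 0ℚ else goodFrom A σ' (e ∷ seen) (e' ∷ es)) ≡ 0ℚ
    step σ' rewrite goodFrom-exhausted σ' (e ∷ seen) (e' ∷ es) seen-all
                  | if-eta (elem (out σ') (e ∷ seen)) {0ℚ} = *-zeroʳ (trans σ e σ')

  errorProb-exhausted : ∀ {m} (es : Vec (Fin n) (suc m)) →
                        AllOutputsSeen (receiveAll es []) → errorProb A es ≡ 1q
  errorProb-exhausted es seen-all = cong (1q -_) (sumFin-zero states weighted-good≡0)
    where
    weighted-good≡0 : ∀ σ → init σ * goodFrom A σ [] es ≡ 0ℚ
    weighted-good≡0 σ rewrite goodFrom-exhausted σ [] es seen-all = *-zeroʳ (init σ)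

  outputStream : ∀ {l} → states ≤ l → Fin n → Vec (Fin n) l
  outputStream states≤l padding = padRight states≤l padding (tabulate out)

  outputStream-exhausts : ∀ {l} (states≤l : states ≤ l) padding →
                          AllOutputsSeen (receiveAll (outputStream states≤l padding) [])
  outputStream-exhausts states≤l padding σ =
    elem-receiveAll [] (∈-padRight⁺ states≤l (∈-tabulate⁺ out σ))

  length<states : ∀ {m} → Fin n → (δ : ℚ) → δ <ℚ 1q → SolvesMIF n (suc m) A δ → suc m < states
  length<states padding δ δ<1 solves = ≰⇒> λ states≤length →
    let es = outputStream states≤length padding
        1≤δ = subst (_≤ℚ δ) (errorProb-exhausted es (outputStream-exhausts states≤length padding))
                    (solves es)
    in <-irrefl refl (≤-<-trans 1≤δ δ<1)

lemma3p6 : (n ℓ z : ℕ) → 1 ≤ ℓ → ℓ < n → (δ : ℚ) → δ <ℚ 1q →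
    (A : RandomTapeAlg n) → UsesSpace A z → SolvesMIF n ℓ A δ →
    ⌈log₂ (ℓ + 1) ⌉ ≤ z
lemma3p6 _       zero    _ ()  _  _ _   _ _     _
lemma3p6 zero    (suc _) _ _   () _ _   _ _     _
lemma3p6 (suc n) (suc m) z _   _  δ δ<1 A space solves =
  subst (⌈log₂ (suc m + 1) ⌉ ≤_) (⌈log₂2^n⌉≡n z) (⌈log₂⌉-mono-≤ (≤-trans ℓ+1≤states space))
  where
  ℓ+1≤states : suc m + 1 ≤ RandomTapeAlg.states A
  ℓ+1≤states rewrite +-comm (suc m) 1 = length<states A zero δ δ<1 solves
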